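{- The weak head reduction $\to_{\mathsf{SN}}$ is deterministic: if $t\to_{\mathsf{SN}} s$ and $t\to_{\mathsf{SN}} s'$, then $s=s'$.
   Context: $\mathbf{KP}$-terms: $t,s,u ::= x \mid t\,s \mid \lambda x.t \mid \mathtt{efq}(t) \mid \langle t,s\rangle \mid \pi_i t \mid \mathtt{in}_i t \mid \mathtt{case}\ t\ [y.s_1]\ [y.s_2] \mid \mathtt{hop}(x.t,\ y.s_1,\ y.s_2)$ ($i\in\{1,2\}$), with $y$ bound in $s_1,s_2$ in $\mathtt{case}$ and $\mathtt{hop}$, $x$ bound in $t$ in $\mathtt{hop}$; terms are up to $\alpha$-equivalence, $t\{x:=s\}$ is capture-avoiding substitution. Weak head $\mathbf{IPC}$ contexts: $W::=\Box\mid W\,t\mid\pi_i W\mid\mathtt{case}\ W\ [y.s_1]\ [y.s_2]$; weak head $\mathbf{KP}$ contexts: $K::=\Box\mid K\,s\mid\pi_i K\mid\mathtt{case}\ K\ [y.s_1]\ [y.s_2]\mid\mathtt{hop}(x.K,\ y.s_1,\ y.s_2)$; $K\langle t\rangle$ replaces the hole by $t$. Top-level reduction $\mapsto_{\mathbf{KP}}$: $(\lambda x.t)s\mapsto t\{x:=s\}$; $\pi_i\langle t_1,t_2\rangle\mapsto t_i$; $\mathtt{case}\,(\mathtt{in}_i t)\,[y.s_1][y.s_2]\mapsto s_i\{y:=t\}$; $\mathtt{hop}(x.\mathtt{in}_i t,y.s_1,y.s_2)\mapsto s_i\{y:=\lambda x.t\}$; $\mathtt{hop}(x.W\langle\mathtt{efq}(t)\rangle,y.s_1,y.s_2)\mapsto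 s_1\{y:=\lambda x.\mathtt{efq}(t)\}$; $\to_{\mathbf{KP}}$ is its closure under all term constructors. $\mathsf{SN}$ is the set of terms strongly normalizing for $\to_{\mathbf{KP}}$; a context is $\mathsf{SN}$ if all terms occurring in it are in $\mathsf{SN}$. $\to_{\mathsf{SN}}$ is defined by: $K\langle(\lambda x.t)s\rangle\to_{\mathsf{SN}} K\langle t\{x:=s\}\rangle$; $K\langle\pi_i\langle s_1,s_2\rangle\rangle\to_{\mathsf{SN}} K\langle s_i\rangle$; $K\langle\mathtt{case}\,(\mathtt{in}_i t)\,[y.s_1][y.s_2]\rangle\to_{\mathsf{SN}} K\langle s_i\{y:=t\}\rangle$; $K\langle\mathtt{hop}(x.\mathtt{in}_i t,y.s_1,y.s_2)\rangle\to_{\mathsf{SN}} K\langle s_i\{y:=\lambda x.t\}\rangle$; $K\langle\mathtt{hop}(x.W\langle\mathtt{efq}(t)\rangle,y.s_1,y.s_2)\rangle\to_{\mathsf{SN}} K\langle s_1\{y:=\lambda x.\mathtt{efq}(t)\}\rangle$; in each case for all $\mathsf{SN}$ contexts $W,K$ and $t,s,s_1,s_2\in\mathsf{SN}$. -}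

module Defs where

open import Data.Nat using (ℕ; zero; suc)
open import Data.Fin using (Fin; zero; suc)
open import Induction.WellFounded using (Acc)

data Idx : Set where
  i₁ i₂ : Idx

sel : {A : Set} → Idx → A → A → A
sel i₁ a b = a
sel i₂ a b = b

-- KP-terms, well-scoped de Bruijn syntax (terms up to α-equivalence).
-- Tm n : terms with at most n free variables.
data Tm (n : ℕ) : Set where
  var  : Fin n → Tm n
  app  : Tm n → Tm n → Tm n
  lam  : Tm (suc n) → Tm n
  efq  : Tm n → Tm n
  pair : Tm n → Tm n → Tm n
  proj : Idx → Tm n → Tm n
  inj  : Idx → Tm n → Tm n
  case : Tm n → Tm (suc n) → Tm (suc n) → Tm n
  hop  : Tm (suc n) → Tm (suc n) → Tm (suc n) → Tm n

Ren : ℕ → ℕ → Set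
Ren m n = Fin m → Fin n

liftR : ∀ {m n} → Ren m n → Ren (suc m) (suc n)
liftR ρ zero    = zero
liftR ρ (suc i) = suc (ρ i)

ren : ∀ {m n} → Ren m n → Tm m → Tm n
ren ρ (var x)        = var (ρ x)
ren ρ (app t s)      = app (ren ρ t) (ren ρ s)
ren ρ (lam t)        = lam (ren (liftR ρ) t)
ren ρ (efq t)        = efq (ren ρ t)
ren ρ (pair t s)     = pair (ren ρ t) (ren ρ s)
ren ρ (proj i t)     = proj i (ren ρ t)
ren ρ (inj i t)      = inj i (ren ρ t)
ren ρ (case t s₁ s₂) = case (ren ρ t) (ren (liftR ρ) s₁) (ren (liftR ρ) s₂)
ren ρ (hop t s₁ s₂)  = hop (ren (liftR ρ) t) (ren (liftR ρ) s₁) (ren (liftR ρ) s₂)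

Sub : ℕ → ℕ → Set
Sub m n = Fin m → Tm n

liftS : ∀ {m n} → Sub m n → Sub (suc m) (suc n)
liftS σ zero    = var zero
liftS σ (suc i) = ren suc (σ i)

sub : ∀ {m n} → Sub m n → Tm m → Tm n
sub σ (var x)        = σ x
sub σ (app t s)      = app (sub σ t) (sub σ s)
sub σ (lam t)        = lam (sub (liftS σ) t)
sub σ (efq t)        = efq (sub σ t)
sub σ (pair t s)     = pair (sub σ t) (sub σ s)
sub σ (proj i t)     = proj i (sub σ t)
sub σ (inj i t)      = inj i (sub σ t)
sub σ (case t s₁ s₂) = case (sub σ t) (sub (liftS σ) s₁) (sub (liftS σ) s₂)
sub σ (hop t s₁ s₂)  = hop (sub (liftS σ) t) (sub (liftS σ) s₁) (sub (liftS σ) s₂)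

sub₀ : ∀ {n} → Tm n → Sub (suc n) n
sub₀ s zero    = s
sub₀ s (suc i) = var i

-- t [ s ]  is  t{x:=s}  where x is the variable bound by the enclosing binder (index 0)
_[_] : ∀ {n} → Tm (suc n) → Tm n → Tm n
t [ s ] = sub (sub₀ s) t

data WCtx (n : ℕ) : Set where
  □     : WCtx n
  appW  : WCtx n → Tm n → WCtx n
  projW : Idx → WCtx n → WCtx n
  caseW : WCtx n → Tm (suc n) → Tm (suc n) → WCtx n

plugW : ∀ {n} → WCtx n → Tm n → Tm n
plugW □               u = u
plugW (appW W t)      u = app (plugW W u) t
plugW (projW i W)     u = proj i (plugW W u)
plugW (caseW W s₁ s₂) u = case (plugW W u) s₁ s₂

-- Weak head KP contexts: KCtx m n has its hole in scope m and lives in scope n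
-- (the hop constructor puts the hole under the binder x).
data KCtx : ℕ → ℕ → Set where
  □     : ∀ {n} → KCtx n n
  appK  : ∀ {m n} → KCtx m n → Tm n → KCtx m n
  projK : ∀ {m n} → Idx → KCtx m n → KCtx m n
  caseK : ∀ {m n} → KCtx m n → Tm (suc n) → Tm (suc n) → KCtx m n
  hopK  : ∀ {m n} → KCtx m (suc n) → Tm (suc n) → Tm (suc n) → KCtx m n

plugK : ∀ {m n} → KCtx m n → Tm m → Tm n
plugK □               u = u
plugK (appK K s)      u = app (plugK K u) s
plugK (projK i K)     u = proj i (plugK K u)
plugK (caseK K s₁ s₂) u = case (plugK K u) s₁ s₂
plugK (hopK K s₁ s₂)  u = hop (plugK K u) s₁ s₂

data _↦_ {n : ℕ} : Tm n → Tm n → Set where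
  β      : ∀ {t s} → app (lam t) s ↦ (t [ s ])
  π      : ∀ {i t₁ t₂} → proj i (pair t₁ t₂) ↦ sel i t₁ t₂
  ι      : ∀ {i t s₁ s₂} → case (inj i t) s₁ s₂ ↦ (sel i s₁ s₂ [ t ])
  hopIn  : ∀ {i t s₁ s₂} → hop (inj i t) s₁ s₂ ↦ (sel i s₁ s₂ [ lam t ])
  hopEfq : ∀ {t s₁ s₂} (W : WCtx (suc n)) →
           hop (plugW W (efq t)) s₁ s₂ ↦ (s₁ [ lam (efq t) ])

data _⟶_ : {n : ℕ} → Tm n → Tm n → Set where
  top   : ∀ {n} {t t' : Tm n} → t ↦ t' → t ⟶ t'
  appˡ  : ∀ {n} {t t' s : Tm n} → t ⟶ t' → app t s ⟶ app t' s
  appʳ  : ∀ {n} {t s s' : Tm n} → s ⟶ s' → app t s ⟶ app t s'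
  lamᶜ  : ∀ {n} {t t' : Tm (suc n)} → t ⟶ t' → lam t ⟶ lam t'
  efqᶜ  : ∀ {n} {t t' : Tm n} → t ⟶ t' → efq t ⟶ efq t'
  pairˡ : ∀ {n} {t t' s : Tm n} → t ⟶ t' → pair t s ⟶ pair t' s
  pairʳ : ∀ {n} {t s s' : Tm n} → s ⟶ s' → pair t s ⟶ pair t s'
  projᶜ : ∀ {n i} {t t' : Tm n} → t ⟶ t' → proj i t ⟶ proj i t'
  injᶜ  : ∀ {n i} {t t' : Tm n} → t ⟶ t' → inj i t ⟶ inj i t'
  case₀ : ∀ {n} {t t' : Tm n} {s₁ s₂} → t ⟶ t' → case t s₁ s₂ ⟶ case t' s₁ s₂
  case₁ : ∀ {n} {t : Tm n} {s₁ s₁' s₂} → s₁ ⟶ s₁' → case t s₁ s₂ ⟶ case t s₁' s₂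
  case₂ : ∀ {n} {t : Tm n} {s₁ s₂ s₂'} → s₂ ⟶ s₂' → case t s₁ s₂ ⟶ case t s₁ s₂'
  hop₀  : ∀ {n} {t t' s₁ s₂ : Tm (suc n)} → t ⟶ t' → hop t s₁ s₂ ⟶ hop t' s₁ s₂
  hop₁  : ∀ {n} {t s₁ s₁' s₂ : Tm (suc n)} → s₁ ⟶ s₁' → hop t s₁ s₂ ⟶ hop t s₁' s₂
  hop₂  : ∀ {n} {t s₁ s₂ s₂' : Tm (suc n)} → s₂ ⟶ s₂' → hop t s₁ s₂ ⟶ hop t s₁ s₂'

SN : ∀ {n} → Tm n → Set
SN {n} = Acc (λ (u t : Tm n) → t ⟶ u)

data SNW {n : ℕ} : WCtx n → Set where
  □     : SNW □
  appW  : ∀ {W t} → SNW W → SN t → SNW (appW W t)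
  projW : ∀ {i W} → SNW W → SNW (projW i W)
  caseW : ∀ {W s₁ s₂} → SNW W → SN s₁ → SN s₂ → SNW (caseW W s₁ s₂)

data SNK : ∀ {m n} → KCtx m n → Set where
  □     : ∀ {n} → SNK (□ {n})
  appK  : ∀ {m n} {K : KCtx m n} {t} → SNK K → SN t → SNK (appK K t)
  projK : ∀ {m n i} {K : KCtx m n} → SNK K → SNK (projK i K)
  caseK : ∀ {m n} {K : KCtx m n} {s₁ s₂} → SNK K → SN s₁ → SN s₂ → SNK (caseK K s₁ s₂)
  hopK  : ∀ {m n} {K : KCtx m (suc n)} {s₁ s₂} → SNK K → SN s₁ → SN s₂ → SNK (hopK K s₁ s₂)

data _⟶SN_ {n : ℕ} : Tm n → Tm n → Set where
  β      : ∀ {m} (K : KCtx m n) {t : Tm (suc m)} {s : Tm m} →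
           SNK K → SN t → SN s →
           plugK K (app (lam t) s) ⟶SN plugK K (t [ s ])
  π      : ∀ {m} (K : KCtx m n) {i} {s₁ s₂ : Tm m} →
           SNK K → SN s₁ → SN s₂ →
           plugK K (proj i (pair s₁ s₂)) ⟶SN plugK K (sel i s₁ s₂)
  ι      : ∀ {m} (K : KCtx m n) {i} {t : Tm m} {s₁ s₂ : Tm (suc m)} →
           SNK K → SN t → SN s₁ → SN s₂ →
           plugK K (case (inj i t) s₁ s₂) ⟶SN plugK K (sel i s₁ s₂ [ t ])
  hopIn  : ∀ {m} (K : KCtx m n) {i} {t s₁ s₂ : Tm (suc m)} →
           SNK K → SN t → SN s₁ → SN s₂ →
           plugK K (hop (inj i t) s₁ s₂) ⟶SN plugK K (sel i s₁ s₂ [ lam t ])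
  hopEfq : ∀ {m} (K : KCtx m n) (W : WCtx (suc m)) {t s₁ s₂ : Tm (suc m)} →
           SNK K → SNW W → SN t → SN s₁ → SN s₂ →
           plugK K (hop (plugW W (efq t)) s₁ s₂) ⟶SN plugK K (s₁ [ lam (efq t) ])

module Submission where

-- A step t →SN s fires a redex at the hole of a weak head KP context K;
-- the SN side conditions only restrict which steps exist.  We therefore forget them: every →SN step is a
-- step of the purely structural weak head relation _⇒ʰ_, which fires a
-- top-level redex and is closed only under the frames of KP contexts.
--
-- The heart of the argument is that _⇒ʰ_ is deterministic.  The redexes
-- have pairwise distinct head shapes, and a redex never reduces inside
-- its principal position (lam, pair, inj are not reducible by _⇒ʰ_), so
-- at most one rule applies.  The only subtle case is the hop-efq rule,
-- whose body W⟨efq t⟩ is described by the predicate EfqHead: such a body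
-- determines t uniquely and admits no weak head step itself, so it cannot
-- overlap with the congruence rule for hop nor with the hop-in rule.

open import Defs
open import Data.Nat using (ℕ; suc)
open import Data.Empty using (⊥; ⊥-elim)
open import Relation.Binary.PropositionalEquality using (_≡_; refl; cong)

data EfqHead {n : ℕ} : Tm n → Tm n → Set where
  here  : ∀ {t} → EfqHead (efq t) t
  appE  : ∀ {u t s} → EfqHead u t → EfqHead (app u s) t
  projE : ∀ {i u t} → EfqHead u t → EfqHead (proj i u) t
  caseE : ∀ {u t s₁ s₂} → EfqHead u t → EfqHead (case u s₁ s₂) t

plugW-efqHead : ∀ {n} (W : WCtx n) {t : Tm n} → EfqHead (plugW W (efq t)) t
plugW-efqHead □               = here
plugW-efqHead (appW W s)      = appE (plugW-efqHead W)
plugW-efqHead (projW i W)     = projE (plugW-efqHead W)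
plugW-efqHead (caseW W s₁ s₂) = caseE (plugW-efqHead W)

efqHead-unique : ∀ {n} {u t t' : Tm n} → EfqHead u t → EfqHead u t' → t ≡ t'
efqHead-unique here      here       = refl
efqHead-unique (appE e)  (appE e')  = efqHead-unique e e'
efqHead-unique (projE e) (projE e') = efqHead-unique e e'
efqHead-unique (caseE e) (caseE e') = efqHead-unique e e'

infix 4 _⇒ʰ_
data _⇒ʰ_ : {n : ℕ} → Tm n → Tm n → Set where
  β      : ∀ {n} {t : Tm (suc n)} {s} → app (lam t) s ⇒ʰ t [ s ]
  π      : ∀ {n i} {t₁ t₂ : Tm n} → proj i (pair t₁ t₂) ⇒ʰ sel i t₁ t₂
  ι      : ∀ {n i} {t : Tm n} {s₁ s₂} → case (inj i t) s₁ s₂ ⇒ʰ sel i s₁ s₂ [ t ]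
  hopIn  : ∀ {n i} {t s₁ s₂ : Tm (suc n)} →
           hop (inj i t) s₁ s₂ ⇒ʰ sel i s₁ s₂ [ lam t ]
  hopEfq : ∀ {n} {u t s₁ s₂ : Tm (suc n)} → EfqHead u t →
           hop u s₁ s₂ ⇒ʰ s₁ [ lam (efq t) ]
  appᶜ   : ∀ {n} {t t' s : Tm n} → t ⇒ʰ t' → app t s ⇒ʰ app t' s
  projᶜ  : ∀ {n i} {t t' : Tm n} → t ⇒ʰ t' → proj i t ⇒ʰ proj i t'
  caseᶜ  : ∀ {n} {t t' : Tm n} {s₁ s₂} → t ⇒ʰ t' → case t s₁ s₂ ⇒ʰ case t' s₁ s₂
  hopᶜ   : ∀ {n} {t t' s₁ s₂ : Tm (suc n)} → t ⇒ʰ t' → hop t s₁ s₂ ⇒ʰ hop t' s₁ s₂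

plugK-⇒ʰ : ∀ {m n} (K : KCtx m n) {r r' : Tm m} → r ⇒ʰ r' → plugK K r ⇒ʰ plugK K r'
plugK-⇒ʰ □               h = h
plugK-⇒ʰ (appK K s)      h = appᶜ (plugK-⇒ʰ K h)
plugK-⇒ʰ (projK i K)     h = projᶜ (plugK-⇒ʰ K h)
plugK-⇒ʰ (caseK K s₁ s₂) h = caseᶜ (plugK-⇒ʰ K h)
plugK-⇒ʰ (hopK K s₁ s₂)  h = hopᶜ (plugK-⇒ʰ K h)

⟶SN⇒⇒ʰ : ∀ {n} {t s : Tm n} → t ⟶SN s → t ⇒ʰ s
⟶SN⇒⇒ʰ (β K _ _ _)            = plugK-⇒ʰ K β
⟶SN⇒⇒ʰ (π K _ _ _)            = plugK-⇒ʰ K π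
⟶SN⇒⇒ʰ (ι K _ _ _ _)          = plugK-⇒ʰ K ι
⟶SN⇒⇒ʰ (hopIn K _ _ _ _)      = plugK-⇒ʰ K hopIn
⟶SN⇒⇒ʰ (hopEfq K W _ _ _ _ _) = plugK-⇒ʰ K (hopEfq (plugW-efqHead W))

efqHead-stuck : ∀ {n} {u t u' : Tm n} → EfqHead u t → u ⇒ʰ u' → ⊥
efqHead-stuck (appE ())  β
efqHead-stuck (appE e)   (appᶜ h)  = efqHead-stuck e h
efqHead-stuck (projE ()) π
efqHead-stuck (projE e)  (projᶜ h) = efqHead-stuck e h
efqHead-stuck (caseE ()) ι
efqHead-stuck (caseE e)  (caseᶜ h) = efqHead-stuck e h

⇒ʰ-deterministic : ∀ {n} {t s s' : Tm n} → t ⇒ʰ s → t ⇒ʰ s' → s ≡ s'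
⇒ʰ-deterministic β          β           = refl
⇒ʰ-deterministic β          (appᶜ ())
⇒ʰ-deterministic π          π           = refl
⇒ʰ-deterministic π          (projᶜ ())
⇒ʰ-deterministic ι          ι           = refl
⇒ʰ-deterministic ι          (caseᶜ ())
⇒ʰ-deterministic hopIn      hopIn       = refl
⇒ʰ-deterministic hopIn      (hopEfq ())
⇒ʰ-deterministic hopIn      (hopᶜ ())
⇒ʰ-deterministic (hopEfq ()) hopIn
⇒ʰ-deterministic (hopEfq {s₁ = s₁} e) (hopEfq e') =
  cong (λ t → s₁ [ lam (efq t) ]) (efqHead-unique e e')
⇒ʰ-deterministic (hopEfq e) (hopᶜ h)    = ⊥-elim (efqHead-stuck e h)
⇒ʰ-deterministic (appᶜ ())  β
⇒ʰ-deterministic (appᶜ h)   (appᶜ h')   = cong (λ t → app t _) (⇒ʰ-deterministic h h')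
⇒ʰ-deterministic (projᶜ ()) π
⇒ʰ-deterministic (projᶜ h)  (projᶜ h')  = cong (proj _) (⇒ʰ-deterministic h h')
⇒ʰ-deterministic (caseᶜ ()) ι
⇒ʰ-deterministic (caseᶜ h)  (caseᶜ h')  = cong (λ t → case t _ _) (⇒ʰ-deterministic h h')
⇒ʰ-deterministic (hopᶜ ())  hopIn
⇒ʰ-deterministic (hopᶜ h)   (hopEfq e)  = ⊥-elim (efqHead-stuck e h)
⇒ʰ-deterministic (hopᶜ h)   (hopᶜ h')   = cong (λ t → hop t _ _) (⇒ʰ-deterministic h h')

mainTheorem10 : ∀ {n} {t s s' : Tm n} → t ⟶SN s → t ⟶SN s' → s ≡ s'
mainTheorem10 r r' = ⇒ʰ-deterministic (⟶SN⇒⇒ʰ r) (⟶SN⇒⇒ʰ r')
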